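{- For every $n\geq 1$ there exists an irredundant tropical product of $\binom{n+1}{3}$ lossy phone call matrices $C_{kl}(a)$ with $k,l\in[n]$.
   Context: Tropical multiplication: $(A\odot B)_{ij}=\min_k (a_{ik}+b_{kj})$. For distinct $k,l\in[n]=\{1,\ldots,n\}$ and $a\in[0,\infty]$, the lossy phone call matrix $C_{kl}(a)$ is the $n\times n$ matrix with zeroes on the diagonal, $a$ at positions $(k,l)$ and $(l,k)$, and $\infty$ elsewhere. A product expression is irredundant if leaving out any one factor changes the value of the product. -}

module Defs where

open import Data.Nat using (ℕ; zero; suc; _+_; _⊓_)
open import Data.Fin using (Fin; zero; suc; _≟_)
open import Data.List using (List; []; _∷_; foldr; length; map; removeAt)
open import Data.Bool using (Bool; true; false; _∧_; _∨_; if_then_else_)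
open import Relation.Nullary using (¬_; does)
open import Relation.Binary.PropositionalEquality using (_≡_; _≢_)

data ℕ∞ : Set where
  fin : ℕ → ℕ∞
  ∞   : ℕ∞

_⊕_ : ℕ∞ → ℕ∞ → ℕ∞
fin x ⊕ fin y = fin (x ⊓ y)
fin x ⊕ ∞     = fin x
∞     ⊕ y     = y

_⊗_ : ℕ∞ → ℕ∞ → ℕ∞
fin x ⊗ fin y = fin (x + y)
fin x ⊗ ∞     = ∞
∞     ⊗ y     = ∞

minFin : {n : ℕ} → (Fin n → ℕ∞) → ℕ∞
minFin {zero}  f = ∞
minFin {suc n} f = f zero ⊕ minFin (λ i → f (suc i))

Matrix : ℕ → Set
Matrix n = Fin n → Fin n → ℕ∞

_⊙_ : {n : ℕ} → Matrix n → Matrix n → Matrix n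
(A ⊙ B) i j = minFin (λ k → A i k ⊗ B k j)

I : {n : ℕ} → Matrix n
I i j = if does (i ≟ j) then fin 0 else ∞

prod : {n : ℕ} → List (Matrix n) → Matrix n
prod = foldr _⊙_ I

_≈ᴹ_ : {n : ℕ} → Matrix n → Matrix n → Set
A ≈ᴹ B = ∀ i j → A i j ≡ B i j

Irredundant : {n : ℕ} → List (Matrix n) → Set
Irredundant Ms = (p : Fin (length Ms)) → ¬ (prod (removeAt Ms p) ≈ᴹ prod Ms)

record Call (n : ℕ) : Set where
  constructor call
  field
    k   : Fin n
    l   : Fin n
    k≢l : k ≢ l
    a   : ℕ∞

phoneCall : {n : ℕ} → Call n → Matrix n
phoneCall (call k l _ a) i j =
  if does (i ≟ j) then fin 0
  else if (does (i ≟ k) ∧ does (j ≟ l)) ∨ (does (i ≟ l) ∧ does (j ≟ k)) then a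
  else ∞

module Submission where

-- The construction on m + 1 vertices
-- is the construction on m vertices, shifted to vertices 1 … m, followed by a
-- new level: for t = m, m − 1, …, 0 the path 0–1–…–t (of t calls), each of
-- whose calls has value (m+1)^t · E, where E bounds all witness values used so
-- far. The level has 0 + 1 + … + m = (m+1 choose 2) calls, so the count
-- (n+1 choose 3) follows from Pascal's rule.
--
-- Irredundancy is certified entrywise: for each call we exhibit an entry (i, j)
-- and a value v with the full product at most v there, while the product with
-- that call deleted is at least v + 1. For a call on the path to t the entry
-- is (0, t): the path costs t · (m+1)^t · E, deleting a call disconnects the
-- path, later paths avoid t, and earlier (heavier) paths cost more. For an
-- old call the old certificate survives the shift, because the new calls are
-- all heavier than E.

open import Defs
open import Data.Nat as ℕ using (ℕ; zero; suc; _+_; _*_; _^_; _≤_; _<_; z≤n; s≤s; NonZero)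
open import Data.Nat.Properties
  using (≤-refl; ≤-trans; ≤-<-trans; <-≤-trans; <-irrefl; m⊓n≤m; m⊓n≤n; ⊓-glb; ⊓-comm; ⊓-assoc;
         m≤m+n; m≤n+m; +-mono-≤; +-identityʳ; +-assoc; +-comm; +-distribˡ-⊓; +-distribʳ-⊓;
         *-assoc; *-monoˡ-<; *-monoˡ-≤; ^-monoʳ-≤; m^n≢0; m*n≢0; m≤n*m; module ≤-Reasoning)
open import Data.Nat.Combinatorics using (_C_; nC1≡n; nCk+nC[k+1]≡[n+1]C[k+1])
open import Data.Nat.ListAction using (sum)
open import Data.Fin using (Fin; zero; suc; _≟_; toℕ; fromℕ; inject₁; _>_)
open import Data.Fin.Properties using (suc-injective; toℕ<n; toℕ-fromℕ; toℕ-inject₁; inject₁ℕ<)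
open import Data.List using (List; []; _∷_; _++_; map; length; removeAt)
open import Data.List.Properties using (map-++; ++-assoc; ++-identityʳ; length-++; length-map; map-∘; map-cong)
open import Data.List.Relation.Unary.All as All using (All; []; _∷_)
import Data.List.Relation.Unary.All.Properties as All
open import Data.List.Relation.Unary.All.Properties using (++⁺)
open import Data.List.Relation.Unary.AllPairs as AllPairs using (AllPairs; []; _∷_)
import Data.List.Relation.Unary.AllPairs.Properties as AllPairs
open import Data.Bool using (true; false; _∧_; _∨_)
open import Data.Bool.Properties using (∧-zeroʳ)
open import Data.Empty using (⊥-elim)
open import Data.Product using (Σ; _×_; _,_)
open import Data.Sum using (_⊎_; inj₁; inj₂)
open import Relation.Nullary using (¬_; does; yes; no)
open import Relation.Binary.PropositionalEquality


infix 4 _≤∞_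
data _≤∞_ : ℕ∞ → ℕ∞ → Set where
  fin≤ : ∀ {x y} → x ≤ y → fin x ≤∞ fin y
  ≤∞-top : ∀ {x} → x ≤∞ ∞

≤∞-refl : ∀ {x} → x ≤∞ x
≤∞-refl {fin x} = fin≤ ≤-refl
≤∞-refl {∞}     = ≤∞-top

≤∞-trans : ∀ {x y z} → x ≤∞ y → y ≤∞ z → x ≤∞ z
≤∞-trans (fin≤ p) (fin≤ q) = fin≤ (≤-trans p q)
≤∞-trans _        ≤∞-top   = ≤∞-top

≤∞-reflexive : ∀ {x y} → x ≡ y → x ≤∞ y
≤∞-reflexive refl = ≤∞-refl

fin-suc≰ : ∀ {v} → ¬ (fin (suc v) ≤∞ fin v)
fin-suc≰ (fin≤ h) = <-irrefl refl h

⊕-lowerˡ : ∀ x y → x ⊕ y ≤∞ x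
⊕-lowerˡ (fin x) (fin y) = fin≤ (m⊓n≤m x y)
⊕-lowerˡ (fin x) ∞       = ≤∞-refl
⊕-lowerˡ ∞       y       = ≤∞-top

⊕-lowerʳ : ∀ x y → x ⊕ y ≤∞ y
⊕-lowerʳ (fin x) (fin y) = fin≤ (m⊓n≤n x y)
⊕-lowerʳ (fin x) ∞       = ≤∞-top
⊕-lowerʳ ∞       y       = ≤∞-refl

⊕-glb : ∀ {z x y} → z ≤∞ x → z ≤∞ y → z ≤∞ x ⊕ y
⊕-glb (fin≤ p) (fin≤ q) = fin≤ (⊓-glb p q)
⊕-glb (fin≤ p) ≤∞-top   = fin≤ p
⊕-glb ≤∞-top   q        = q

⊗-upperˡ : ∀ x y → x ≤∞ x ⊗ y
⊗-upperˡ (fin x) (fin y) = fin≤ (m≤m+n x y)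
⊗-upperˡ (fin x) ∞       = ≤∞-top
⊗-upperˡ ∞       y       = ≤∞-top

⊗-upperʳ : ∀ x y → y ≤∞ x ⊗ y
⊗-upperʳ (fin x) (fin y) = fin≤ (m≤n+m y x)
⊗-upperʳ (fin x) ∞       = ≤∞-top
⊗-upperʳ ∞       (fin y) = ≤∞-top
⊗-upperʳ ∞       ∞       = ≤∞-top

⊗-mono : ∀ {x x′ y y′} → x ≤∞ x′ → y ≤∞ y′ → x ⊗ y ≤∞ x′ ⊗ y′
⊗-mono (fin≤ p) (fin≤ q) = fin≤ (+-mono-≤ p q)
⊗-mono (fin≤ p) ≤∞-top   = ≤∞-top
⊗-mono ≤∞-top   q        = ≤∞-top

⊕-identityʳ : ∀ x → x ⊕ ∞ ≡ x
⊕-identityʳ (fin x) = refl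
⊕-identityʳ ∞       = refl

⊕-comm : ∀ x y → x ⊕ y ≡ y ⊕ x
⊕-comm (fin x) (fin y) = cong fin (⊓-comm x y)
⊕-comm (fin x) ∞       = refl
⊕-comm ∞       (fin y) = refl
⊕-comm ∞       ∞       = refl

⊕-assoc : ∀ x y z → (x ⊕ y) ⊕ z ≡ x ⊕ (y ⊕ z)
⊕-assoc (fin x) (fin y) (fin z) = cong fin (⊓-assoc x y z)
⊕-assoc (fin x) (fin y) ∞       = refl
⊕-assoc (fin x) ∞       z       = refl
⊕-assoc ∞       y       z       = refl

⊗-identityˡ : ∀ x → fin 0 ⊗ x ≡ x
⊗-identityˡ (fin x) = refl
⊗-identityˡ ∞       = refl

⊗-identityʳ : ∀ x → x ⊗ fin 0 ≡ x
⊗-identityʳ (fin x) = cong fin (+-identityʳ x)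
⊗-identityʳ ∞       = refl

⊗-zeroʳ : ∀ x → x ⊗ ∞ ≡ ∞
⊗-zeroʳ (fin x) = refl
⊗-zeroʳ ∞       = refl

⊗-assoc : ∀ x y z → (x ⊗ y) ⊗ z ≡ x ⊗ (y ⊗ z)
⊗-assoc (fin x) (fin y) (fin z) = cong fin (+-assoc x y z)
⊗-assoc (fin x) (fin y) ∞       = refl
⊗-assoc (fin x) ∞       z       = refl
⊗-assoc ∞       y       z       = refl

⊗-distribˡ-⊕ : ∀ x y z → x ⊗ (y ⊕ z) ≡ (x ⊗ y) ⊕ (x ⊗ z)
⊗-distribˡ-⊕ (fin x) (fin y) (fin z) = cong fin (+-distribˡ-⊓ x y z)
⊗-distribˡ-⊕ (fin x) (fin y) ∞       = refl
⊗-distribˡ-⊕ (fin x) ∞       z       = refl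
⊗-distribˡ-⊕ ∞       y       z       = refl

⊗-distribʳ-⊕ : ∀ x y z → (y ⊕ z) ⊗ x ≡ (y ⊗ x) ⊕ (z ⊗ x)
⊗-distribʳ-⊕ (fin x) (fin y) (fin z) = cong fin (+-distribʳ-⊓ x y z)
⊗-distribʳ-⊕ ∞       (fin y) (fin z) = refl
⊗-distribʳ-⊕ x       (fin y) ∞       = sym (⊕-identityʳ _)
⊗-distribʳ-⊕ x       ∞       z       = refl

minFin-cong : ∀ {n} {f g : Fin n → ℕ∞} → (∀ k → f k ≡ g k) → minFin f ≡ minFin g
minFin-cong {zero}  e = refl
minFin-cong {suc n} e = cong₂ _⊕_ (e zero) (minFin-cong (λ k → e (suc k)))

minFin-lower : ∀ {n} (f : Fin n → ℕ∞) k → minFin f ≤∞ f k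
minFin-lower f zero    = ⊕-lowerˡ _ _
minFin-lower f (suc k) = ≤∞-trans (⊕-lowerʳ _ _) (minFin-lower (λ i → f (suc i)) k)

minFin-glb : ∀ {n z} (f : Fin n → ℕ∞) → (∀ k → z ≤∞ f k) → z ≤∞ minFin f
minFin-glb {zero}  f h = ≤∞-top
minFin-glb {suc n} f h = ⊕-glb (h zero) (minFin-glb (λ i → f (suc i)) (λ k → h (suc k)))

minFin-∞ : ∀ {n} (f : Fin n → ℕ∞) → (∀ k → f k ≡ ∞) → minFin f ≡ ∞
minFin-∞ {zero}  f h = refl
minFin-∞ {suc n} f h rewrite h zero = minFin-∞ (λ i → f (suc i)) (λ k → h (suc k))

minFin-single : ∀ {n} (f : Fin n → ℕ∞) i → (∀ k → k ≢ i → f k ≡ ∞) → minFin f ≡ f i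
minFin-single f zero h
  rewrite minFin-∞ (λ k → f (suc k)) (λ k → h (suc k) (λ ())) = ⊕-identityʳ _
minFin-single f (suc i) h rewrite h zero (λ ()) =
  minFin-single (λ k → f (suc k)) i (λ k k≢i → h (suc k) (λ e → k≢i (suc-injective e)))

minFin-⊕ : ∀ {n} (f g : Fin n → ℕ∞) → minFin (λ k → f k ⊕ g k) ≡ minFin f ⊕ minFin g
minFin-⊕ {zero}  f g = refl
minFin-⊕ {suc n} f g rewrite minFin-⊕ (λ i → f (suc i)) (λ i → g (suc i)) = begin
    (a ⊕ b) ⊕ (c ⊕ d) ≡⟨ ⊕-assoc a b (c ⊕ d) ⟩
    a ⊕ (b ⊕ (c ⊕ d)) ≡⟨ cong (a ⊕_) (sym (⊕-assoc b c d)) ⟩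
    a ⊕ ((b ⊕ c) ⊕ d) ≡⟨ cong (λ u → a ⊕ (u ⊕ d)) (⊕-comm b c) ⟩
    a ⊕ ((c ⊕ b) ⊕ d) ≡⟨ cong (a ⊕_) (⊕-assoc c b d) ⟩
    a ⊕ (c ⊕ (b ⊕ d)) ≡⟨ sym (⊕-assoc a c (b ⊕ d)) ⟩
    (a ⊕ c) ⊕ (b ⊕ d) ∎
  where
  open ≡-Reasoning
  a b c d : ℕ∞
  a = f zero
  b = g zero
  c = minFin (λ i → f (suc i))
  d = minFin (λ i → g (suc i))

minFin-swap : ∀ {n m} (f : Fin n → Fin m → ℕ∞) →
  minFin (λ k → minFin (λ l → f k l)) ≡ minFin (λ l → minFin (λ k → f k l))
minFin-swap {zero}  {m} f = sym (minFin-∞ {m} (λ _ → ∞) (λ _ → refl))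
minFin-swap {suc n}     f rewrite minFin-swap (λ k l → f (suc k) l) =
  sym (minFin-⊕ (λ l → f zero l) (λ l → minFin (λ k → f (suc k) l)))

⊗-minFinˡ : ∀ {n} x (f : Fin n → ℕ∞) → x ⊗ minFin f ≡ minFin (λ k → x ⊗ f k)
⊗-minFinˡ {zero}  x f = ⊗-zeroʳ x
⊗-minFinˡ {suc n} x f rewrite ⊗-distribˡ-⊕ x (f zero) (minFin (λ i → f (suc i))) =
  cong ((x ⊗ f zero) ⊕_) (⊗-minFinˡ x (λ i → f (suc i)))

⊗-minFinʳ : ∀ {n} x (f : Fin n → ℕ∞) → minFin f ⊗ x ≡ minFin (λ k → f k ⊗ x)
⊗-minFinʳ {zero}  x f = refl
⊗-minFinʳ {suc n} x f rewrite ⊗-distribʳ-⊕ x (f zero) (minFin (λ i → f (suc i))) =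
  cong ((f zero ⊗ x) ⊕_) (⊗-minFinʳ x (λ i → f (suc i)))

⊙-assoc : ∀ {n} (A B C : Matrix n) → (A ⊙ (B ⊙ C)) ≈ᴹ ((A ⊙ B) ⊙ C)
⊙-assoc A B C i j = begin
  minFin (λ k → A i k ⊗ minFin (λ l → B k l ⊗ C l j))
    ≡⟨ minFin-cong (λ k → ⊗-minFinˡ (A i k) (λ l → B k l ⊗ C l j)) ⟩
  minFin (λ k → minFin (λ l → A i k ⊗ (B k l ⊗ C l j)))
    ≡⟨ minFin-swap (λ k l → A i k ⊗ (B k l ⊗ C l j)) ⟩
  minFin (λ l → minFin (λ k → A i k ⊗ (B k l ⊗ C l j)))
    ≡⟨ minFin-cong (λ l → minFin-cong (λ k → sym (⊗-assoc (A i k) (B k l) (C l j)))) ⟩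
  minFin (λ l → minFin (λ k → (A i k ⊗ B k l) ⊗ C l j))
    ≡⟨ minFin-cong (λ l → sym (⊗-minFinʳ (C l j) (λ k → A i k ⊗ B k l))) ⟩
  minFin (λ l → minFin (λ k → A i k ⊗ B k l) ⊗ C l j) ∎
  where open ≡-Reasoning

does-≟-refl : ∀ {n} (i : Fin n) → does (i ≟ i) ≡ true
does-≟-refl i with i ≟ i
... | yes _   = refl
... | no  i≢i = ⊥-elim (i≢i refl)

does-≟-≢ : ∀ {n} {i j : Fin n} → i ≢ j → does (i ≟ j) ≡ false
does-≟-≢ {i = i} {j} i≢j with i ≟ j
... | yes i≡j = ⊥-elim (i≢j i≡j)
... | no  _   = refl

I-diag : ∀ {n} (i : Fin n) → I i i ≡ fin 0
I-diag i rewrite does-≟-refl i = refl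

I-off : ∀ {n} {i j : Fin n} → i ≢ j → I i j ≡ ∞
I-off i≢j rewrite does-≟-≢ i≢j = refl

I-⊙ : ∀ {n} (B : Matrix n) → (I ⊙ B) ≈ᴹ B
I-⊙ B i j = begin
  minFin (λ k → I i k ⊗ B k j)
    ≡⟨ minFin-single _ i (λ k k≢i → cong (_⊗ B k j) (I-off (λ i≡k → k≢i (sym i≡k)))) ⟩
  I i i ⊗ B i j ≡⟨ cong (_⊗ B i j) (I-diag i) ⟩
  fin 0 ⊗ B i j ≡⟨ ⊗-identityˡ (B i j) ⟩
  B i j ∎
  where open ≡-Reasoning

prod-++ : ∀ {n} (As Bs : List (Matrix n)) → prod (As ++ Bs) ≈ᴹ (prod As ⊙ prod Bs)
prod-++ []       Bs i j = sym (I-⊙ (prod Bs) i j)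
prod-++ (A ∷ As) Bs i j =
  trans (minFin-cong (λ k → cong (A i k ⊗_) (prod-++ As Bs k j)))
        (⊙-assoc A (prod As) (prod Bs) i j)

∏ : ∀ {n} → List (Call n) → Matrix n
∏ cs = prod (map phoneCall cs)

∏-++ : ∀ {n} (A B : List (Call n)) → ∏ (A ++ B) ≈ᴹ (∏ A ⊙ ∏ B)
∏-++ A B i j rewrite map-++ phoneCall A B = prod-++ (map phoneCall A) (map phoneCall B) i j

∏-++-upper : ∀ {n} (A B : List (Call n)) i k j → ∏ (A ++ B) i j ≤∞ ∏ A i k ⊗ ∏ B k j
∏-++-upper A B i k j =
  ≤∞-trans (≤∞-reflexive (∏-++ A B i j)) (minFin-lower (λ l → ∏ A i l ⊗ ∏ B l j) k)

∏-++-lower : ∀ {n z} (A B : List (Call n)) i j →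
  (∀ k → z ≤∞ ∏ A i k ⊗ ∏ B k j) → z ≤∞ ∏ (A ++ B) i j
∏-++-lower A B i j h =
  ≤∞-trans (minFin-glb (λ l → ∏ A i l ⊗ ∏ B l j) h) (≤∞-reflexive (sym (∏-++ A B i j)))

phoneCall-diag : ∀ {n} (c : Call n) i → phoneCall c i i ≡ fin 0
phoneCall-diag c i rewrite does-≟-refl i = refl

phoneCall-off : ∀ {n w} (c : Call n) {i j} → i ≢ j → fin w ≤∞ Call.a c → fin w ≤∞ phoneCall c i j
phoneCall-off (call k l _ a) {i} {j} i≢j w≤a rewrite does-≟-≢ i≢j
  with (does (i ≟ k) ∧ does (j ≟ l)) ∨ (does (i ≟ l) ∧ does (j ≟ k))
... | true  = w≤a
... | false = ≤∞-top

∏-diag : ∀ {n} (cs : List (Call n)) i → ∏ cs i i ≤∞ fin 0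
∏-diag []       i = ≤∞-reflexive (I-diag i)
∏-diag (c ∷ cs) i =
  ≤∞-trans (minFin-lower (λ k → phoneCall c i k ⊗ ∏ cs k i) i)
    (≤∞-trans (≤∞-reflexive zero-step) (∏-diag cs i))
  where
  zero-step : phoneCall c i i ⊗ ∏ cs i i ≡ ∏ cs i i
  zero-step = trans (cong (_⊗ ∏ cs i i) (phoneCall-diag c i)) (⊗-identityˡ (∏ cs i i))

AtLeast : ∀ {n} → ℕ → List (Call n) → Set
AtLeast w cs = All (λ c → fin w ≤∞ Call.a c) cs

AtLeast-weaken : ∀ {n w w′} → w′ ≤ w → {cs : List (Call n)} → AtLeast w cs → AtLeast w′ cs
AtLeast-weaken w′≤w = All.map (≤∞-trans (fin≤ w′≤w))

-- If all calls carry value at least w, so does every off-diagonal entry of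
-- the product: any route from i to j uses at least one call.
∏-off : ∀ {n w} (cs : List (Call n)) → AtLeast w cs → ∀ {i j} → i ≢ j → fin w ≤∞ ∏ cs i j
∏-off {w = w} []       []          i≢j = subst (fin w ≤∞_) (sym (I-off i≢j)) ≤∞-top
∏-off         (c ∷ cs) (w≤c ∷ w≤cs) {i} {j} i≢j =
  minFin-glb (λ k → phoneCall c i k ⊗ ∏ cs k j) via
  where
  via : ∀ k → fin _ ≤∞ phoneCall c i k ⊗ ∏ cs k j
  via k with k ≟ i
  ... | yes refl = ≤∞-trans (∏-off cs w≤cs i≢j) (⊗-upperʳ _ _)
  ... | no  k≢i  = ≤∞-trans (phoneCall-off c (λ i≡k → k≢i (sym i≡k)) w≤c) (⊗-upperˡ _ _)

Avoids : ∀ {n} → Fin n → Call n → Set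
Avoids x c = (Call.k c ≢ x) × (Call.l c ≢ x)

phoneCall-avoid-row : ∀ {n} (c : Call n) x j → Avoids x c → phoneCall c x j ≡ I x j
phoneCall-avoid-row (call k l _ a) x j (k≢x , l≢x)
  rewrite does-≟-≢ {i = x} {k} (λ e → k≢x (sym e)) | does-≟-≢ {i = x} {l} (λ e → l≢x (sym e))
  with does (x ≟ j)
... | true  = refl
... | false = refl

phoneCall-avoid-col : ∀ {n} (c : Call n) i x → Avoids x c → phoneCall c i x ≡ I i x
phoneCall-avoid-col (call k l _ a) i x (k≢x , l≢x)
  rewrite does-≟-≢ {i = x} {k} (λ e → k≢x (sym e)) | does-≟-≢ {i = x} {l} (λ e → l≢x (sym e))
        | ∧-zeroʳ (does (i ≟ k)) | ∧-zeroʳ (does (i ≟ l))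
  with does (i ≟ x)
... | true  = refl
... | false = refl

∏-avoid-row : ∀ {n} (cs : List (Call n)) x j → All (Avoids x) cs → ∏ cs x j ≡ I x j
∏-avoid-row []       x j []            = refl
∏-avoid-row (c ∷ cs) x j (c-av ∷ cs-av) = begin
  minFin (λ k → phoneCall c x k ⊗ ∏ cs k j)
    ≡⟨ minFin-single _ x (λ k k≢x → cong (_⊗ ∏ cs k j)
         (trans (phoneCall-avoid-row c x k c-av) (I-off (λ x≡k → k≢x (sym x≡k))))) ⟩
  phoneCall c x x ⊗ ∏ cs x j ≡⟨ cong (_⊗ ∏ cs x j) (phoneCall-diag c x) ⟩
  fin 0 ⊗ ∏ cs x j           ≡⟨ ⊗-identityˡ _ ⟩
  ∏ cs x j                   ≡⟨ ∏-avoid-row cs x j cs-av ⟩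
  I x j ∎
  where open ≡-Reasoning

∏-avoid-col : ∀ {n} (cs : List (Call n)) i x → All (Avoids x) cs → ∏ cs i x ≡ I i x
∏-avoid-col []       i x []            = refl
∏-avoid-col (c ∷ cs) i x (c-av ∷ cs-av) = begin
  minFin (λ k → phoneCall c i k ⊗ ∏ cs k x)
    ≡⟨ minFin-single _ x (λ k k≢x → trans (cong (phoneCall c i k ⊗_)
         (trans (∏-avoid-col cs k x cs-av) (I-off k≢x))) (⊗-zeroʳ _)) ⟩
  phoneCall c i x ⊗ ∏ cs x x ≡⟨ cong (phoneCall c i x ⊗_) (trans (∏-avoid-col cs x x cs-av) (I-diag x)) ⟩
  phoneCall c i x ⊗ fin 0    ≡⟨ ⊗-identityʳ _ ⟩
  phoneCall c i x            ≡⟨ phoneCall-avoid-col c i x c-av ⟩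
  I i x ∎
  where open ≡-Reasoning

∏-avoid-prefix : ∀ {n} (A F : List (Call n)) x j → All (Avoids x) A → ∏ (A ++ F) x j ≡ ∏ F x j
∏-avoid-prefix A F x j A-av = begin
  ∏ (A ++ F) x j     ≡⟨ ∏-++ A F x j ⟩
  (∏ A ⊙ ∏ F) x j    ≡⟨ minFin-cong (λ k → cong (_⊗ ∏ F k j) (∏-avoid-row A x k A-av)) ⟩
  (I ⊙ ∏ F) x j      ≡⟨ I-⊙ (∏ F) x j ⟩
  ∏ F x j ∎
  where open ≡-Reasoning

-- Embedding calls on n vertices into n + 1 vertices, shifting every vertex
-- up by one, so that the new vertex 0 is avoided.
liftCall : ∀ {n} → Call n → Call (suc n)
liftCall (call k l k≢l a) = call (suc k) (suc l) (λ e → k≢l (suc-injective e)) a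

lift-avoids-zero : ∀ {n} (cs : List (Call n)) → All (Avoids zero) (map liftCall cs)
lift-avoids-zero cs = All.map⁺ (All.universal (λ _ → (λ ()) , (λ ())) cs)

lift-AtLeast : ∀ {n w} {cs : List (Call n)} → AtLeast w cs → AtLeast w (map liftCall cs)
lift-AtLeast = All.map⁺

phoneCall-lift-to-zero : ∀ {n} (c : Call n) i → phoneCall (liftCall c) (suc i) zero ≡ ∞
phoneCall-lift-to-zero (call k l _ a) i rewrite ∧-zeroʳ (does (i ≟ k)) | ∧-zeroʳ (does (i ≟ l)) = refl

∏-lift : ∀ {n} (cs : List (Call n)) i j → ∏ (map liftCall cs) (suc i) (suc j) ≡ ∏ cs i j
∏-lift []       i j = refl
∏-lift (c ∷ cs) i j rewrite phoneCall-lift-to-zero c i =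
  minFin-cong (λ k → cong (phoneCall c i k ⊗_) (∏-lift cs k j))

-- It certifies that the
-- two products differ, and the bound lets later, heavier calls preserve it.
record RowSeparation {n} (E : ℕ) (i : Fin n) (F G : List (Call n)) : Set where
  constructor separation
  field
    col     : Fin n
    val     : ℕ
    below   : ∏ F i col ≤∞ fin val
    above   : fin (suc val) ≤∞ ∏ G i col
    bounded : val < E

Separation : ∀ {n} → ℕ → List (Call n) → List (Call n) → Set
Separation {n} E F G = Σ (Fin n) λ i → RowSeparation E i F G

Certified : ∀ {n} → ℕ → List (Call n) → Set
Certified E cs = (p : Fin (length cs)) → Separation E cs (removeAt cs p)

-- This is the
-- form in which certificates are assembled segment by segment.
Essential : ∀ {n} → (List (Call n) → List (Call n) → Set) →
  List (Call n) → List (Call n) → List (Call n) → Set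
Essential R Pre Post L = (p : Fin (length L)) → R (Pre ++ L ++ Post) (Pre ++ removeAt L p ++ Post)

removeAt-++ : ∀ {A : Set} (xs ys : List A) (p : Fin (length (xs ++ ys))) →
  (Σ (Fin (length xs)) λ q → removeAt (xs ++ ys) p ≡ removeAt xs q ++ ys) ⊎
  (Σ (Fin (length ys)) λ q → removeAt (xs ++ ys) p ≡ xs ++ removeAt ys q)
removeAt-++ []       ys p       = inj₂ (p , refl)
removeAt-++ (x ∷ xs) ys zero    = inj₁ (zero , refl)
removeAt-++ (x ∷ xs) ys (suc p) with removeAt-++ xs ys p
... | inj₁ (q , e) = inj₁ (suc q , cong (x ∷_) e)
... | inj₂ (q , e) = inj₂ (q , cong (x ∷_) e)

removeAt-map : ∀ {A B : Set} (f : A → B) (xs : List A) (p : Fin (length (map f xs))) →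
  Σ (Fin (length xs)) λ q → removeAt (map f xs) p ≡ map f (removeAt xs q)
removeAt-map f (x ∷ xs) zero    = zero , refl
removeAt-map f (x ∷ xs) (suc p) with removeAt-map f xs p
... | q , e = suc q , cong (f x ∷_) e

Essential-++ : ∀ {n} (R : List (Call n) → List (Call n) → Set) Pre Post A B →
  Essential R Pre (B ++ Post) A → Essential R (Pre ++ A) Post B → Essential R Pre Post (A ++ B)
Essential-++ R Pre Post A B ess-A ess-B p with removeAt-++ A B p
... | inj₁ (q , e) rewrite e | ++-assoc A B Post | ++-assoc (removeAt A q) B Post = ess-A q
... | inj₂ (q , e) rewrite e | ++-assoc A B Post | ++-assoc A (removeAt B q) Post
        | sym (++-assoc Pre A (B ++ Post)) | sym (++-assoc Pre A (removeAt B q ++ Post)) = ess-B q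

Essential⇒Certified : ∀ {n E} (cs : List (Call n)) → Essential (Separation E) [] [] cs → Certified E cs
Essential⇒Certified cs ess p =
  subst₂ (Separation _) (++-identityʳ cs) (++-identityʳ (removeAt cs p)) (ess p)

Certified⇒Irredundant : ∀ {n E} (cs : List (Call n)) → Certified E cs → Irredundant (map phoneCall cs)
Certified⇒Irredundant cs cert p same with removeAt-map phoneCall cs p
... | q , e with cert q
... | i , separation j v below above _ =
  fin-suc≰ (≤∞-trans above (≤∞-trans (≤∞-reflexive unchanged) below))
  where
  unchanged : ∏ (removeAt cs q) i j ≡ ∏ cs i j
  unchanged = trans (cong (λ Ms → prod Ms i j) (sym e)) (same i j)

-- A separation survives shifting all vertices up by one and appending calls
-- of value at least E: on the shifted entry the appended calls can only
-- contribute their (heavy) off-diagonal entries.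
RowSeparation-lift : ∀ {n E E′ i} {F G : List (Call n)} (Heavy : List (Call (suc n))) →
  AtLeast E Heavy → E ≤ E′ → RowSeparation E i F G →
  RowSeparation E′ (suc i) (map liftCall F ++ Heavy) (map liftCall G ++ Heavy)
RowSeparation-lift {i = i} {F} {G} Heavy heavy E≤E′ (separation j v below above v<E) =
  separation (suc j) v below′ above′ (≤-trans v<E E≤E′)
  where
  below′ : ∏ (map liftCall F ++ Heavy) (suc i) (suc j) ≤∞ fin v
  below′ = ≤∞-trans (∏-++-upper (map liftCall F) Heavy (suc i) (suc j) (suc j))
             (≤∞-trans (⊗-mono (≤∞-trans (≤∞-reflexive (∏-lift F i j)) below) (∏-diag Heavy (suc j)))
                       (≤∞-reflexive (⊗-identityʳ (fin v))))
  through : ∀ k → fin (suc v) ≤∞ ∏ (map liftCall G) (suc i) k ⊗ ∏ Heavy k (suc j)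
  through k with k ≟ suc j
  ... | yes refl = ≤∞-trans (≤∞-trans above (≤∞-reflexive (sym (∏-lift G i j)))) (⊗-upperˡ _ _)
  ... | no  k≢j  = ≤∞-trans (fin≤ v<E) (≤∞-trans (∏-off Heavy heavy k≢j) (⊗-upperʳ _ _))
  above′ : fin (suc v) ≤∞ ∏ (map liftCall G ++ Heavy) (suc i) (suc j)
  above′ = ∏-++-lower (map liftCall G) Heavy (suc i) (suc j) through

RowSeparation-prefix : ∀ {n E x} {F G : List (Call n)} (A : List (Call n)) →
  All (Avoids x) A → RowSeparation E x F G → RowSeparation E x (A ++ F) (A ++ G)
RowSeparation-prefix {x = x} {F} {G} A A-av (separation j v below above v<E) =
  separation j v (subst (_≤∞ fin v) (sym (∏-avoid-prefix A F x j A-av)) below)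
                 (subst (fin (suc v) ≤∞_) (sym (∏-avoid-prefix A G x j A-av)) above) v<E

Certified-lift : ∀ {n E E′} (cs : List (Call n)) (Heavy : List (Call (suc n))) →
  AtLeast E Heavy → E ≤ E′ → Certified E cs → Essential (Separation E′) [] Heavy (map liftCall cs)
Certified-lift cs Heavy heavy E≤E′ cert p with removeAt-map liftCall cs p
... | q , e rewrite e with cert q
... | i , sep = suc i , RowSeparation-lift Heavy heavy E≤E′ sep

Essential-prefix : ∀ {n E x} (A L : List (Call n)) → All (Avoids x) A →
  Essential (RowSeparation E x) [] [] L → Essential (Separation E) A [] L
Essential-prefix {x = x} A L A-av ess p = x , RowSeparation-prefix A A-av (ess p)

firstCall : ∀ {m} → ℕ → Call (suc (suc m))
firstCall w = call zero (suc zero) (λ ()) (fin w)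

path : ∀ {m} → ℕ → Fin m → List (Call m)
path {suc m}       w zero    = []
path {suc (suc m)} w (suc t) = firstCall w ∷ map liftCall (path w t)

path-cost : ∀ {m} w (t : Fin (suc m)) → ∏ (path w t) zero t ≤∞ fin (toℕ t * w)
path-cost {m}     w zero    = ≤∞-reflexive (I-diag {suc m} zero)
path-cost {suc m} w (suc t) =
  ≤∞-trans (minFin-lower (λ k → phoneCall (firstCall w) zero k ⊗ ∏ (map liftCall (path w t)) k (suc t))
                         (suc zero))
    (⊗-mono (≤∞-refl {fin w}) (≤∞-trans (≤∞-reflexive (∏-lift (path w t) zero t)) (path-cost w t)))

path-removeAt : ∀ {m} w (t : Fin (suc m)) (p : Fin (length (path w t))) →
  ∏ (removeAt (path w t) p) zero t ≡ ∞
path-removeAt {suc m} w (suc t) zero = ∏-avoid-row (map liftCall (path w t)) zero (suc t) (lift-avoids-zero _)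
path-removeAt {suc m} w (suc t) (suc p) with removeAt-map liftCall (path w t) p
... | q , e rewrite e = minFin-∞ _ blocked
  where
  rest : List (Call (suc m))
  rest = removeAt (path w t) q
  blocked : ∀ k → phoneCall (firstCall w) zero k ⊗ ∏ (map liftCall rest) k (suc t) ≡ ∞
  blocked zero rewrite ∏-avoid-row (map liftCall rest) zero (suc t) (lift-avoids-zero rest) = refl
  blocked (suc zero) rewrite ∏-lift rest zero t | path-removeAt w t q = refl
  blocked (suc (suc k)) = refl

path-AtLeast : ∀ {m} w (t : Fin m) → AtLeast w (path w t)
path-AtLeast {suc m}       w zero    = []
path-AtLeast {suc (suc m)} w (suc t) = fin≤ ≤-refl ∷ lift-AtLeast (path-AtLeast w t)

Within : ∀ {n} → ℕ → Call n → Set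
Within r c = (toℕ (Call.k c) ≤ r) × (toℕ (Call.l c) ≤ r)

lift-Within : ∀ {n r} {cs : List (Call n)} → All (Within r) cs → All (Within (suc r)) (map liftCall cs)
lift-Within []                    = []
lift-Within ((k≤r , l≤r) ∷ cs-in) = (s≤s k≤r , s≤s l≤r) ∷ lift-Within cs-in

path-within : ∀ {m} w (t : Fin m) → All (Within (toℕ t)) (path w t)
path-within {suc m}       w zero    = []
path-within {suc (suc m)} w (suc t) = (z≤n , s≤s z≤n) ∷ lift-Within (path-within w t)

Within⇒Avoids : ∀ {n r} {u : Fin n} → r < toℕ u → ∀ {c} → Within r c → Avoids u c
Within⇒Avoids r<u (k≤r , l≤r) =
  (λ { refl → <-irrefl refl (≤-<-trans k≤r r<u) }) , (λ { refl → <-irrefl refl (≤-<-trans l≤r r<u) })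

-- In a context whose prefix X is heavier than t · w and whose suffix Y avoids
-- t, every call of the path to t is essential, witnessed by entry (0, t):
-- the full product has it at most t · w, while after a deletion the suffix
-- cannot reach t and the prefix can only leave 0 at a cost above t · w.
path-essential : ∀ {m E} w (t : Fin (suc m)) (X Y : List (Call (suc m))) →
  AtLeast (suc (toℕ t * w)) X → All (Avoids t) Y → toℕ t * w < E →
  Essential (RowSeparation E zero) X Y (path w t)
path-essential w t X Y X-heavy Y-av cost<E p = separation t cost below above cost<E
  where
  cost : ℕ
  cost = toℕ t * w
  P R : List (Call (suc _))
  P = path w t
  R = removeAt P p
  below : ∏ (X ++ P ++ Y) zero t ≤∞ fin cost
  below = ≤∞-trans (∏-++-upper X (P ++ Y) zero zero t)
           (≤∞-trans (⊗-mono (∏-diag X zero) (∏-++-upper P Y zero t t))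
             (≤∞-trans (⊗-mono (≤∞-refl {fin 0}) (⊗-mono (path-cost w t) (∏-diag Y t)))
               (≤∞-reflexive (trans (⊗-identityˡ _) (⊗-identityʳ (fin cost))))))
  cut : ∀ l → ∏ R zero l ⊗ ∏ Y l t ≡ ∞
  cut l with l ≟ t
  ... | yes refl rewrite path-removeAt w t p = refl
  ... | no  l≢t  rewrite ∏-avoid-col Y l t Y-av | I-off l≢t = ⊗-zeroʳ _
  disconnected : ∏ (R ++ Y) zero t ≡ ∞
  disconnected = trans (∏-++ R Y zero t) (minFin-∞ _ cut)
  leave : ∀ k → fin (suc cost) ≤∞ ∏ X zero k ⊗ ∏ (R ++ Y) k t
  leave zero rewrite disconnected = subst (fin (suc cost) ≤∞_) (sym (⊗-zeroʳ (∏ X zero zero))) ≤∞-top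
  leave (suc k) = ≤∞-trans (∏-off X X-heavy (λ ())) (⊗-upperˡ _ _)
  above : fin (suc cost) ≤∞ ∏ (X ++ R ++ Y) zero t
  above = ∏-++-lower X (R ++ Y) zero t leave


paths : ∀ {m} → (Fin (suc m) → ℕ) → List (Fin (suc m)) → List (Call (suc m))
paths f []       = []
paths f (t ∷ ts) = path (f t) t ++ paths f ts

paths-AtLeast : ∀ {m W} (f : Fin (suc m) → ℕ) → (∀ t → W ≤ f t) → ∀ ts → AtLeast W (paths f ts)
paths-AtLeast f W≤f []       = []
paths-AtLeast f W≤f (t ∷ ts) = ++⁺ (AtLeast-weaken (W≤f t) (path-AtLeast (f t) t)) (paths-AtLeast f W≤f ts)

paths-avoid : ∀ {m} f {u : Fin (suc m)} ts → All (u >_) ts → All (Avoids u) (paths f ts)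
paths-avoid f []       []                = []
paths-avoid f (t ∷ ts) (u>t ∷ u>ts) =
  ++⁺ (All.map (λ {c} → Within⇒Avoids u>t {c}) (path-within (f t) t)) (paths-avoid f ts u>ts)

-- The
-- prefix X must be heavier than the costs of all remaining paths; appending
-- the path to t keeps it so, by the growth condition.
paths-essential : ∀ {m E} (f : Fin (suc m) → ℕ) →
  (∀ {t t′} → t > t′ → toℕ t′ * f t′ < f t) →
  ∀ ts X → AllPairs _>_ ts → All (λ t → AtLeast (suc (toℕ t * f t)) X) ts →
  All (λ t → toℕ t * f t < E) ts → Essential (RowSeparation E zero) X [] (paths f ts)
paths-essential f growth [] X [] [] [] ()
paths-essential {E = E} f growth (t ∷ ts) X (t>ts ∷ decreasing) (X-heavy ∷ X-heavy-ts) (cost<E ∷ costs<E) =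
  Essential-++ (RowSeparation E zero) X [] (path (f t) t) (paths f ts)
    (path-essential (f t) t X (paths f ts ++ []) X-heavy (++⁺ (paths-avoid f ts t>ts) []) cost<E)
    (paths-essential f growth ts (X ++ path (f t) t) decreasing
      (All.zipWith extend (X-heavy-ts , t>ts)) costs<E)
  where
  extend : ∀ {t′} → AtLeast (suc (toℕ t′ * f t′)) X × t > t′ →
           AtLeast (suc (toℕ t′ * f t′)) (X ++ path (f t) t)
  extend (X-heavy′ , t>t′) = ++⁺ X-heavy′ (AtLeast-weaken (growth t>t′) (path-AtLeast (f t) t))

targets : (m : ℕ) → List (Fin (suc m))
targets zero    = zero ∷ []
targets (suc m) = fromℕ (suc m) ∷ map inject₁ (targets m)

targets-decreasing : ∀ m → AllPairs _>_ (targets m)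
targets-decreasing zero    = [] ∷ []
targets-decreasing (suc m) =
  All.map⁺ (All.universal top>inject (targets m)) ∷
  AllPairs.map⁺ (AllPairs.map inject>inject (targets-decreasing m))
  where
  top>inject : ∀ t → fromℕ (suc m) > inject₁ t
  top>inject t = subst (toℕ (inject₁ t) <_) (sym (toℕ-fromℕ (suc m))) (inject₁ℕ< t)
  inject>inject : ∀ {t t′} → t > t′ → inject₁ t > inject₁ t′
  inject>inject {t} {t′} = subst₂ _<_ (sym (toℕ-inject₁ t′)) (sym (toℕ-inject₁ t))

weight : (m : ℕ) → ℕ → Fin (suc m) → ℕ
weight m E t = suc m ^ toℕ t * E

power-gap : ∀ b {a} E .{{_ : NonZero E}} → a ≤ b → a * (suc b ^ a * E) < suc b ^ suc a * E
power-gap b {a} E a≤b = begin-strict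
  a * (suc b ^ a * E)     <⟨ *-monoˡ-< (suc b ^ a * E) {{m*n≢0 (suc b ^ a) E {{m^n≢0 (suc b) a}}}} (s≤s a≤b) ⟩
  suc b * (suc b ^ a * E) ≡⟨ sym (*-assoc (suc b) (suc b ^ a) E) ⟩
  suc b ^ suc a * E ∎
  where open ≤-Reasoning

power-mono : ∀ b E {c d} → c ≤ d → suc b ^ c * E ≤ suc b ^ d * E
power-mono b E c≤d = *-monoˡ-≤ E (^-monoʳ-≤ (suc b) c≤d)

weight-growth : ∀ m E .{{_ : NonZero E}} {t t′ : Fin (suc m)} → t > t′ →
  toℕ t′ * weight m E t′ < weight m E t
weight-growth m E {t} {t′} t>t′ =
  <-≤-trans (power-gap m E (ℕ.s≤s⁻¹ (toℕ<n t′))) (power-mono m E t>t′)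

weight-bound : ∀ m E .{{_ : NonZero E}} (t : Fin (suc m)) → toℕ t * weight m E t < suc m ^ suc m * E
weight-bound m E t = <-≤-trans (power-gap m E (ℕ.s≤s⁻¹ (toℕ<n t))) (power-mono m E (toℕ<n t))

weight-≥ : ∀ m E (t : Fin (suc m)) → E ≤ weight m E t
weight-≥ m E t = m≤n*m E (suc m ^ toℕ t) {{m^n≢0 (suc m) (toℕ t)}}

-- All separating values at level m stay below bound m.
bound : ℕ → ℕ
bound zero    = 1
bound (suc m) = suc m ^ suc m * bound m

bound-nonZero : ∀ m → NonZero (bound m)
bound-nonZero zero    = _
bound-nonZero (suc m) = m*n≢0 (suc m ^ suc m) (bound m) {{m^n≢0 (suc m) (suc m)}} {{bound-nonZero m}}

bound-mono : ∀ m → bound m ≤ bound (suc m)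
bound-mono m = m≤n*m (bound m) (suc m ^ suc m) {{m^n≢0 (suc m) (suc m)}}

level : (m : ℕ) → List (Call (suc m))
level m = paths (weight m (bound m)) (targets m)

level-AtLeast : ∀ m → AtLeast (bound m) (level m)
level-AtLeast m = paths-AtLeast (weight m (bound m)) (weight-≥ m (bound m)) (targets m)

construction : (n : ℕ) → List (Call n)
construction zero    = []
construction (suc m) = map liftCall (construction m) ++ level m

certified : ∀ n → Certified (bound n) (construction n)
certified zero    ()
certified (suc m) = Essential⇒Certified (construction (suc m))
  (Essential-++ (Separation (bound (suc m))) [] [] (map liftCall (construction m)) (level m) old new)
  where
  E : ℕ
  E = bound m
  old : Essential (Separation (bound (suc m))) [] (level m ++ []) (map liftCall (construction m))
  old = Certified-lift (construction m) (level m ++ []) (++⁺ (level-AtLeast m) []) (bound-mono m) (certified m)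
  new : Essential (Separation (bound (suc m))) (map liftCall (construction m)) [] (level m)
  new = Essential-prefix (map liftCall (construction m)) (level m) (lift-avoids-zero (construction m))
          (paths-essential (weight m E) (weight-growth m E {{bound-nonZero m}})
            (targets m) [] (targets-decreasing m)
            (All.universal (λ _ → []) (targets m))
            (All.universal (weight-bound m E {{bound-nonZero m}}) (targets m)))

length-path : ∀ {m} w (t : Fin m) → length (path w t) ≡ toℕ t
length-path {suc m}       w zero    = refl
length-path {suc (suc m)} w (suc t) = cong suc (trans (length-map liftCall (path w t)) (length-path w t))

length-paths : ∀ {m} (f : Fin (suc m) → ℕ) ts → length (paths f ts) ≡ sum (map toℕ ts)
length-paths f []       = refl
length-paths f (t ∷ ts) =
  trans (length-++ (path (f t) t)) (cong₂ _+_ (length-path (f t) t) (length-paths f ts))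

sum-targets : ∀ m → sum (map toℕ (targets m)) ≡ suc m C 2
sum-targets zero    = refl
sum-targets (suc m) = begin
  toℕ (fromℕ (suc m)) + sum (map toℕ (map inject₁ (targets m)))
    ≡⟨ cong₂ _+_ (toℕ-fromℕ (suc m))
         (cong sum (trans (sym (map-∘ (targets m))) (map-cong toℕ-inject₁ (targets m)))) ⟩
  suc m + sum (map toℕ (targets m)) ≡⟨ cong₂ _+_ (sym (nC1≡n (suc m))) (sum-targets m) ⟩
  suc m C 1 + suc m C 2             ≡⟨ nCk+nC[k+1]≡[n+1]C[k+1] (suc m) 1 ⟩
  suc (suc m) C 2 ∎
  where open ≡-Reasoning

length-level : ∀ m → length (level m) ≡ suc m C 2
length-level m = trans (length-paths (weight m (bound m)) (targets m)) (sum-targets m)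

length-construction : ∀ n → length (construction n) ≡ suc n C 3
length-construction zero    = refl
length-construction (suc m) = begin
  length (map liftCall (construction m) ++ level m)
    ≡⟨ length-++ (map liftCall (construction m)) ⟩
  length (map liftCall (construction m)) + length (level m)
    ≡⟨ cong₂ _+_ (trans (length-map liftCall (construction m)) (length-construction m)) (length-level m) ⟩
  suc m C 3 + suc m C 2 ≡⟨ +-comm (suc m C 3) (suc m C 2) ⟩
  suc m C 2 + suc m C 3 ≡⟨ nCk+nC[k+1]≡[n+1]C[k+1] (suc m) 2 ⟩
  suc (suc m) C 3 ∎
  where open ≡-Reasoning

lemma2p5 : (n : ℕ) → 1 ≤ n →
    Σ (List (Call n)) (λ cs → (length cs ≡ (suc n) C 3) × Irredundant (map phoneCall cs))
lemma2p5 n _ =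
  construction n , length-construction n , Certified⇒Irredundant (construction n) (certified n)
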